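{- Let $n\ge 1$ and $s\ge 0$ be integers. Let $\mathcal{D}_n^{(s)}$ be the set of integer sequences $(u_1,\ldots,u_n)$ satisfying $u_i\ge 1$ for all $i$, $u_n=n+s$, and such that for all $1\le i<j\le n$, $u_j-(j-i)\notin[1,u_i-1]$. Then $|\mathcal{D}_n^{(s)}|=C_{n-1}^{(s)}$, where $C_m^{(s)}=\frac{s+1}{2m+s+1}\binom{2m+s+1}{m}$.
   Context: $[a,b]$ denotes the set of integers $m$ with $a\le m\le b$ (empty if $b<a$). -}

module Defs where

open import Data.Nat as ℕ using (ℕ; suc; _+_; _*_; _∸_)
open import Data.Nat.DivMod using (_/_)
open import Data.Nat.Combinatorics using (_C_)
open import Data.Integer as ℤ using (ℤ; +_; _-_)
open import Data.Fin using (Fin; toℕ) renaming (_<_ to _<ᶠ_)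
open import Data.Vec using (Vec; lookup)
open import Data.Product using (_×_)
open import Relation.Nullary using (¬_)
open import Relation.Binary.PropositionalEquality using (_≡_)

_∈[_,_] : ℤ → ℤ → ℤ → Set
m ∈[ a , b ] = (a ℤ.≤ m) × (m ℤ.≤ b)

-- A sequence (u_1,…,u_n) is stored as a vector u : Vec ℤ n, with u_i = lookup u (i-1).
-- u ∈ D_n^(s); the entry with toℕ i ≡ n ∸ 1 is u_n; j - i is toℕ j ∸ toℕ i (j > i)
InD : (n s : ℕ) → Vec ℤ n → Set
InD n s u =
    ((i : Fin n) → + 1 ℤ.≤ lookup u i)
  × ((i : Fin n) → toℕ i ≡ n ∸ 1 → lookup u i ≡ + (n + s))
  × ((i j : Fin n) → i <ᶠ j →
       ¬ ((lookup u j - + (toℕ j ∸ toℕ i)) ∈[ + 1 , lookup u i - + 1 ]))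

-- C_m^(s) = (s+1)/(2m+s+1) * binom(2m+s+1, m)  (an integer; the division is exact)
Cat : ℕ → ℕ → ℕ
Cat m s = ((s + 1) * (suc (2 * m + s) C m)) / suc (2 * m + s)

-- Read a sequence of D_n^(s) from the left. Each entry u_i lies in [1, i] or exceeds i by a
-- "gap" from a finite set S; initially S = [1, s], since the pair (i, n) with u_n = n + s forces
-- u_i ≤ i + s. Choosing u_1 = 1 + h with h ∈ {0} ∪ S and renumbering the remaining entries from 1,
-- the constraints on them are of the same form, with gap set {t + 1 | t ∈ {0} ∪ S, t ≥ h}. Hence the
-- number of sequences depends only on n and |S| and satisfies the ballot recursion
-- N(k+1, m) = N(k, m+1) + N(k, m) + ⋯ + N(k, 1), N(0, m) = 1, whose solution is
-- N(k, m) = C(2k+m, k) − C(2k+m, k−1) = (m+1)/(2k+m+1) · C(2k+m+1, k).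
module Submission where

open import Defs
open import Data.Nat using (ℕ; zero; suc; _+_; _*_; _∸_; _≤_; _<_; z≤n; s≤s; s≤s⁻¹; z<s; s<s; _≤?_)
open import Data.Nat.Properties
open import Data.Nat.DivMod using (_/_; m*n/n≡m)
open import Data.Nat.Combinatorics using (_C_; nCk+nC[k+1]≡[n+1]C[k+1]; nCk≡nC[n∸k]; nC1≡n)
open import Data.Nat.ListAction using (sum)
open import Data.Nat.Tactic.RingSolver using (solve-∀)
open import Data.Integer as ℤ using (ℤ; +_; _-_)
import Data.Integer.Properties as ℤ
open import Data.Fin as Fin using (Fin; toℕ; fromℕ)
open import Data.Fin.Properties using (toℕ-fromℕ; toℕ-injective; toℕ≤pred[n])
open import Data.Vec using (Vec; []; _∷_; lookup)
open import Data.Vec.Properties using (∷-injectiveʳ)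
open import Data.List using (List; []; _∷_; map; filter; length; _++_; applyUpTo)
open import Data.List.Properties
  using ( length-++; length-map; length-applyUpTo; map-cong; map-cong-local
        ; filter-accept; filter-reject; filter-all)
open import Data.List.Membership.Propositional using (_∈_)
open import Data.List.Membership.Propositional.Properties
  using (∈-map⁺; ∈-map⁻; ∈-filter⁺; ∈-filter⁻; ∈-++⁺ˡ; ∈-++⁺ʳ; ∈-++⁻; ∈-applyUpTo⁺)
open import Data.List.Relation.Unary.Any using (here; there)
open import Data.List.Relation.Unary.All as All using (All; []; _∷_)
import Data.List.Relation.Unary.All.Properties as All
open import Data.List.Relation.Unary.AllPairs as AllPairs using (AllPairs; []; _∷_)
import Data.List.Relation.Unary.AllPairs.Properties as AllPairs
open import Data.List.Relation.Unary.Unique.Propositional using (Unique)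
import Data.List.Relation.Unary.Unique.Propositional.Properties as Unique
open import Data.Product using (Σ; ∃-syntax; _×_; _,_; proj₁; proj₂)
open import Data.Sum using (_⊎_; inj₁; inj₂)
open import Function.Base using (_∘_; id)
open import Function.Bundles using (_⇔_; mk⇔; Equivalence)
import Function.Properties.Equivalence as ⇔
open import Relation.Nullary using (¬_; contradiction; yes; no)
open import Relation.Binary.PropositionalEquality

open Equivalence

private
  pascal : ∀ n k → suc n C suc k ≡ n C k + n C suc k
  pascal n k = sym (nCk+nC[k+1]≡[n+1]C[k+1] n k)

[m+n]Cm≡[m+n]Cn : ∀ m n → (m + n) C m ≡ (m + n) C n
[m+n]Cm≡[m+n]Cn m n = trans (nCk≡nC[n∸k] (m≤m+n m n)) (cong ((m + n) C_) (m+n∸m≡n m n))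

[k+1]*[n+1]C[k+1]≡[n+1]*nCk : ∀ n k → suc k * (suc n C suc k) ≡ suc n * (n C k)
[k+1]*[n+1]C[k+1]≡[n+1]*nCk n       zero    =
  trans (+-identityʳ _) (trans (nC1≡n (suc n)) (sym (*-identityʳ (suc n))))
[k+1]*[n+1]C[k+1]≡[n+1]*nCk zero    (suc k) = *-zeroʳ (suc (suc k))
[k+1]*[n+1]C[k+1]≡[n+1]*nCk (suc n) (suc k) = begin
  suc (suc k) * (suc (suc n) C suc (suc k))
    ≡⟨ cong (suc (suc k) *_) (pascal (suc n) (suc k)) ⟩
  suc (suc k) * (X + Y)
    ≡⟨ distribute k X Y ⟩
  suc k * X + X + suc (suc k) * Y
    ≡⟨ cong₂ (λ a b → a + X + b) (absorb k) (absorb (suc k)) ⟩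
  suc n * (n C k) + X + suc n * (n C suc k)
    ≡⟨ cong (λ x → suc n * (n C k) + x + suc n * (n C suc k)) (pascal n k) ⟩
  suc n * (n C k) + (n C k + n C suc k) + suc n * (n C suc k)
    ≡⟨ collect n (n C k) (n C suc k) ⟩
  suc (suc n) * (n C k + n C suc k)
    ≡⟨ cong (suc (suc n) *_) (pascal n k) ⟨
  suc (suc n) * X
    ∎
  where
  open ≡-Reasoning
  X Y : ℕ
  X = suc n C suc k
  Y = suc n C suc (suc k)
  absorb : ∀ k → suc k * (suc n C suc k) ≡ suc n * (n C k)
  absorb = [k+1]*[n+1]C[k+1]≡[n+1]*nCk n
  distribute : ∀ k x y → suc (suc k) * (x + y) ≡ suc k * x + x + suc (suc k) * y
  distribute = solve-∀
  collect : ∀ n x y → suc n * x + (x + y) + suc n * y ≡ suc (suc n) * (x + y)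
  collect = solve-∀

sum₁ : ℕ → (ℕ → ℕ) → ℕ
sum₁ zero    f = 0
sum₁ (suc m) f = f (suc m) + sum₁ m f

ballot : ℕ → ℕ → ℕ
ballot zero    m = 1
ballot (suc k) m = sum₁ (suc m) (ballot k)

ballot-1 : ∀ m → ballot 1 m ≡ suc m
ballot-1 zero    = refl
ballot-1 (suc m) = cong suc (ballot-1 m)

ballot-suc-zero : ∀ k → ballot (suc k) 0 ≡ ballot k 1
ballot-suc-zero k = +-identityʳ (ballot k 1)

ballot-suc-suc : ∀ k m → ballot (suc k) (suc m) ≡ ballot k (suc (suc m)) + ballot (suc k) m
ballot-suc-suc k m = refl

-- The index n is passed with an equation so that the recursive calls need no rewriting of n.
ballot[k+1]+nCk≡nC[k+1] : ∀ k m {n} → n ≡ suc (suc (k + k + m)) →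
  ballot (suc k) m + n C k ≡ n C suc k
ballot[k+1]+nCk≡nC[k+1] zero m refl = begin
  ballot 1 m + 1    ≡⟨ cong (_+ 1) (ballot-1 m) ⟩
  suc m + 1         ≡⟨ +-comm (suc m) 1 ⟩
  suc (suc m)       ≡⟨ nC1≡n (suc (suc m)) ⟨
  suc (suc m) C 1   ∎
  where open ≡-Reasoning
ballot[k+1]+nCk≡nC[k+1] (suc k) zero {suc n} eq = begin
  ballot (suc (suc k)) 0 + suc n C suc k  ≡⟨ cong₂ _+_ (ballot-suc-zero (suc k)) (pascal n k) ⟩
  ballot (suc k) 1 + (n C k + n C suc k)  ≡⟨ +-assoc (ballot (suc k) 1) (n C k) (n C suc k) ⟨
  ballot (suc k) 1 + n C k + n C suc k    ≡⟨ cong (_+ (n C suc k)) (ballot[k+1]+nCk≡nC[k+1] k 1 n≡′) ⟩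
  n C suc k + n C suc k                   ≡⟨ cong (λ x → n C suc k + x) symmetric ⟩
  n C suc k + n C suc (suc k)             ≡⟨ pascal n (suc k) ⟨
  suc n C suc (suc k)                     ∎
  where
  open ≡-Reasoning
  n≡ : n ≡ suc (suc k) + suc k
  n≡ = trans (suc-injective eq) (cong (λ x → suc (suc x)) (+-identityʳ (k + suc k)))
  reindex : ∀ k → suc (suc k) + suc k ≡ suc (suc (k + k + 1))
  reindex = solve-∀
  n≡′ : n ≡ suc (suc (k + k + 1))
  n≡′ = trans n≡ (reindex k)
  symmetric : n C suc k ≡ n C suc (suc k)
  symmetric rewrite n≡ = sym ([m+n]Cm≡[m+n]Cn (suc (suc k)) (suc k))
ballot[k+1]+nCk≡nC[k+1] (suc k) (suc m) {suc n} eq = begin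
  ballot (suc (suc k)) (suc m) + suc n C suc k
    ≡⟨ cong₂ _+_ (ballot-suc-suc (suc k) m) (pascal n k) ⟩
  (ballot (suc k) (suc (suc m)) + ballot (suc (suc k)) m) + (n C k + n C suc k)
    ≡⟨ interchange (ballot (suc k) (suc (suc m))) (ballot (suc (suc k)) m) (n C k) (n C suc k) ⟩
  (ballot (suc k) (suc (suc m)) + n C k) + (ballot (suc (suc k)) m + n C suc k)
    ≡⟨ cong₂ _+_ (ballot[k+1]+nCk≡nC[k+1] k (suc (suc m)) (trans (suc-injective eq) (reindexˡ k m)))
                 (ballot[k+1]+nCk≡nC[k+1] (suc k) m (trans (suc-injective eq) (reindexʳ k m))) ⟩
  n C suc k + n C suc (suc k)
    ≡⟨ pascal n (suc k) ⟨
  suc n C suc (suc k)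
    ∎
  where
  open ≡-Reasoning
  interchange : ∀ a b c d → (a + b) + (c + d) ≡ (a + c) + (b + d)
  interchange = solve-∀
  reindexˡ : ∀ k m → suc (suc k + suc k + suc m) ≡ suc (suc (k + k + suc (suc m)))
  reindexˡ = solve-∀
  reindexʳ : ∀ k m → suc (suc k + suc k + suc m) ≡ suc (suc (suc k + suc k + m))
  reindexʳ = solve-∀

private
  module _ (j s : ℕ) where
    M : ℕ
    M = suc (suc (j + j + s))

    ballot+MCj≡MC[j+1] : ballot (suc j) s + M C j ≡ M C suc j
    ballot+MCj≡MC[j+1] = ballot[k+1]+nCk≡nC[k+1] j s refl

    [j+1]*ballot≡[s+1]*MCj : suc j * ballot (suc j) s ≡ (s + 1) * (M C j)
    [j+1]*ballot≡[s+1]*MCj = +-cancelʳ-≡ ((suc j + suc j) * X) _ _ (begin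
      suc j * b + (suc j + suc j) * X   ≡⟨ expand j b X ⟩
      suc j * (X + (b + X))             ≡⟨ cong (λ y → suc j * (X + y)) ballot+MCj≡MC[j+1] ⟩
      suc j * (X + M C suc j)           ≡⟨ cong (suc j *_) (pascal M j) ⟨
      suc j * (suc M C suc j)           ≡⟨ [k+1]*[n+1]C[k+1]≡[n+1]*nCk M j ⟩
      suc M * X                         ≡⟨ split j s X ⟩
      (s + 1) * X + (suc j + suc j) * X ∎)
      where
      open ≡-Reasoning
      X b : ℕ
      X = M C j
      b = ballot (suc j) s
      expand : ∀ j b x → suc j * b + (suc j + suc j) * x ≡ suc j * (x + (b + x))
      expand = solve-∀
      split : ∀ j s x → suc (suc (suc (j + j + s))) * x ≡ (s + 1) * x + (suc j + suc j) * x
      split = solve-∀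

    [s+1]*[M+1]C[j+1]≡ballot*[M+1] : (s + 1) * (suc M C suc j) ≡ ballot (suc j) s * suc M
    [s+1]*[M+1]C[j+1]≡ballot*[M+1] = begin
      (s + 1) * (suc M C suc j)        ≡⟨ cong ((s + 1) *_) (pascal M j) ⟩
      (s + 1) * (X + M C suc j)        ≡⟨ cong (λ y → (s + 1) * (X + y)) ballot+MCj≡MC[j+1] ⟨
      (s + 1) * (X + (b + X))          ≡⟨ expand s b X ⟩
      (s + 1) * b + 2 * ((s + 1) * X)  ≡⟨ cong (λ y → (s + 1) * b + 2 * y) [j+1]*ballot≡[s+1]*MCj ⟨
      (s + 1) * b + 2 * (suc j * b)    ≡⟨ collect j s b ⟩
      b * suc M                        ∎
      where
      open ≡-Reasoning
      X b : ℕ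
      X = M C j
      b = ballot (suc j) s
      expand : ∀ s b x → (s + 1) * (x + (b + x)) ≡ (s + 1) * b + 2 * ((s + 1) * x)
      expand = solve-∀
      collect : ∀ j s b → (s + 1) * b + 2 * (suc j * b) ≡ b * suc (suc (suc (j + j + s)))
      collect = solve-∀

[s+1]*[2k+s+1]Ck≡ballot*[2k+s+1] : ∀ k s → (s + 1) * (suc (2 * k + s) C k) ≡ ballot k s * suc (2 * k + s)
[s+1]*[2k+s+1]Ck≡ballot*[2k+s+1] zero    s =
  trans (*-identityʳ (s + 1)) (trans (+-comm s 1) (sym (*-identityˡ (suc s))))
[s+1]*[2k+s+1]Ck≡ballot*[2k+s+1] (suc j) s =
  subst (λ n → (s + 1) * (suc n C suc j) ≡ ballot (suc j) s * suc n)
        (reindex j s) ([s+1]*[M+1]C[j+1]≡ballot*[M+1] j s)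
  where
  reindex : ∀ j s → suc (suc (j + j + s)) ≡ 2 * suc j + s
  reindex = solve-∀

Cat≡ballot : ∀ k s → Cat k s ≡ ballot k s
Cat≡ballot k s =
  trans (cong (_/ suc (2 * k + s)) ([s+1]*[2k+s+1]Ck≡ballot*[2k+s+1] k s))
        (m*n/n≡m (ballot k s) (suc (2 * k + s)))

+[m+n]-+m≡+n : ∀ m n → + (m + n) - + m ≡ + n
+[m+n]-+m≡+n m n =
  trans (ℤ.[+m]-[+n]≡m⊖n (m + n) m) (trans (ℤ.⊖-≥ (m≤m+n m n)) (cong +_ (m+n∸m≡n m n)))

+b-+p∈[1,+t]⇔p<b≤p+t : ∀ p b t → ((+ b - + p) ∈[ + 1 , + t ]) ⇔ (p < b × b ≤ p + t)
+b-+p∈[1,+t]⇔p<b≤p+t p b t with ≤-total p b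
... | inj₂ b≤p = mk⇔
  (λ (1≤b-p , _) → contradiction (ℤ.≤-trans 1≤b-p (ℤ.i≤j⇒i-j≤0 (ℤ.+≤+ b≤p))) λ { (ℤ.+≤+ ()) })
  (λ (p<b , _) → contradiction b≤p (<⇒≱ p<b))
... | inj₁ p≤b with m≤n⇒∃[o]m+o≡n p≤b
...   | c , refl rewrite +[m+n]-+m≡+n p c = mk⇔
  (λ (1≤c , c≤t) → m<m+n p (ℤ.drop‿+≤+ 1≤c) , +-monoʳ-≤ p (ℤ.drop‿+≤+ c≤t))
  (λ (p<p+c , p+c≤p+t) → ℤ.+≤+ (+-cancelˡ-< p 0 c (subst (_< p + c) (sym (+-identityʳ p)) p<p+c))
                       , ℤ.+≤+ (+-cancelˡ-≤ p c t p+c≤p+t))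

Admissible : List ℕ → ℕ → ℕ → Set
Admissible S p a = (1 ≤ a × a ≤ p) ⊎ ∃[ t ] (t ∈ S × a ≡ p + t)

Admissible⇒1≤ : ∀ {S p a} → Admissible S (suc p) a → 1 ≤ a
Admissible⇒1≤ (inj₁ (1≤a , _))      = 1≤a
Admissible⇒1≤ (inj₂ (_ , _ , refl)) = s≤s z≤n

Admissible-1⇔ : ∀ {S a} → Admissible S 1 a ⇔ (∃[ h ] (h ∈ 0 ∷ S × a ≡ suc h))
Admissible-1⇔ = mk⇔
  (λ { (inj₁ (1≤a , a≤1))   → 0 , here refl , ≤-antisym a≤1 1≤a
     ; (inj₂ (t , t∈S , refl)) → t , there t∈S , refl })
  (λ { (_ , here refl , refl)  → inj₁ (≤-refl , ≤-refl)
     ; (h , there h∈S , refl) → inj₂ (h , h∈S , refl) })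

nextGaps : List ℕ → ℕ → List ℕ
nextGaps S h = map suc (filter (h ≤?_) (0 ∷ S))

∈-nextGaps⁺ : ∀ {S h t} → t ∈ 0 ∷ S → h ≤ t → suc t ∈ nextGaps S h
∈-nextGaps⁺ {h = h} t∈ h≤t = ∈-map⁺ suc (∈-filter⁺ (h ≤?_) t∈ h≤t)

∈-nextGaps⁻ : ∀ {S h t′} → t′ ∈ nextGaps S h → ∃[ t ] (t ∈ 0 ∷ S × h ≤ t × t′ ≡ suc t)
∈-nextGaps⁻ {h = h} t′∈ with ∈-map⁻ suc t′∈
... | t , t∈filter , refl with ∈-filter⁻ (h ≤?_) t∈filter
...   | t∈ , h≤t = t , t∈ , h≤t , refl

-- After removing a head 1 + h, tail position p was position p + 1, and the head forbids there
-- exactly the values p + 1, …, p + h.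
Admissible-nextGaps : ∀ S h {p b} →
  Admissible (nextGaps S h) p b ⇔ (Admissible S (suc p) b × ¬ (p < b × b ≤ p + h))
Admissible-nextGaps S h {p} {b} = mk⇔ to′ from′
  where
  survivor : ∀ {t} → t ∈ 0 ∷ S → b ≡ p + suc t → ¬ (b ≤ p + h) → Admissible (nextGaps S h) p b
  survivor t∈ b≡ b≰p+h =
    inj₂ (_ , ∈-nextGaps⁺ {S} {h} t∈ h≤t , b≡)
    where
    h≤t : h ≤ _
    h≤t = s≤s⁻¹ (+-cancelˡ-< p _ _ (subst (p + h <_) b≡ (≰⇒> b≰p+h)))

  to′ : Admissible (nextGaps S h) p b → Admissible S (suc p) b × ¬ (p < b × b ≤ p + h)
  to′ (inj₁ (1≤b , b≤p)) = inj₁ (1≤b , m≤n⇒m≤1+n b≤p) , λ (p<b , _) → <⇒≱ p<b b≤p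
  to′ (inj₂ (t′ , t′∈ , refl)) with ∈-nextGaps⁻ {S} {h} t′∈
  ... | t , t∈ , h≤t , refl = shifted t∈ , λ (_ , b≤p+h) → <⇒≱ (+-monoʳ-< p (s≤s h≤t)) b≤p+h
    where
    shifted : ∀ {t} → t ∈ 0 ∷ S → Admissible S (suc p) (p + suc t)
    shifted (here refl) = inj₁ (m≤n+m 1 p , ≤-reflexive (+-comm p 1))
    shifted (there t∈S) = inj₂ (_ , t∈S , +-suc p _)

  from′ : Admissible S (suc p) b × ¬ (p < b × b ≤ p + h) → Admissible (nextGaps S h) p b
  from′ (inj₁ (1≤b , b≤1+p) , clear) with m≤n⇒m<n∨m≡n b≤1+p
  ... | inj₁ b<1+p = inj₁ (1≤b , s≤s⁻¹ b<1+p)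
  ... | inj₂ refl  = survivor (here refl) (sym (+-comm p 1)) λ b≤p+h → clear (n<1+n p , b≤p+h)
  from′ (inj₂ (t , t∈S , refl) , clear) =
    survivor (there t∈S) (sym (+-suc p t)) λ b≤p+h → clear (s≤s (m≤m+n p t) , b≤p+h)

AdmissibleEntry : List ℕ → ℕ → ℤ → Set
AdmissibleEntry S p y = ∃[ a ] (y ≡ + a × Admissible S p a)

AdmissibleEntry-nextGaps : ∀ S h {p y} →
  AdmissibleEntry (nextGaps S h) p y ⇔ (AdmissibleEntry S (suc p) y × ¬ ((y - + p) ∈[ + 1 , + h ]))
AdmissibleEntry-nextGaps S h {p} = mk⇔
  (λ (a , y≡ , adm) → let (adm′ , clear) = to (Admissible-nextGaps S h) adm in
     (a , y≡ , adm′) , clear ∘ to (window y≡))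
  (λ ((a , y≡ , adm) , clear) →
     a , y≡ , from (Admissible-nextGaps S h) (adm , clear ∘ from (window y≡)))
  where
  window : ∀ {y a} → y ≡ + a → ((y - + p) ∈[ + 1 , + h ]) ⇔ (p < a × a ≤ p + h)
  window refl = +b-+p∈[1,+t]⇔p<b≤p+t p _ h

Separated : ∀ {m} → Vec ℤ m → Set
Separated {m} u = (i j : Fin m) → i Fin.< j →
  ¬ ((lookup u j - + (toℕ j ∸ toℕ i)) ∈[ + 1 , lookup u i - + 1 ])

ClearOf : ∀ {m} → ℤ → Vec ℤ m → Set
ClearOf {m} x v = (j : Fin m) → ¬ ((lookup v j - + suc (toℕ j)) ∈[ + 1 , x - + 1 ])

Separated-∷⁻ : ∀ {m x} {v : Vec ℤ m} → Separated (x ∷ v) → ClearOf x v × Separated v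
Separated-∷⁻ sep =
  (λ j → sep Fin.zero (Fin.suc j) z<s) , (λ i j i<j → sep (Fin.suc i) (Fin.suc j) (s<s i<j))

Separated-∷⁺ : ∀ {m x} {v : Vec ℤ m} → ClearOf x v → Separated v → Separated (x ∷ v)
Separated-∷⁺ clear sep Fin.zero    (Fin.suc j) _         = clear j
Separated-∷⁺ clear sep (Fin.suc i) (Fin.suc j) (s<s i<j) = sep i j i<j

-- Valid S top u: u can follow a prefix that left the gap set S; the condition u_n = n + s becomes
-- "the last entry exceeds its position by top".
Valid : ∀ {k} → List ℕ → ℕ → Vec ℤ (suc k) → Set
Valid {k} S top u =
  (∀ i → AdmissibleEntry S (suc (toℕ i)) (lookup u i)) ×
  Separated u ×
  lookup u (fromℕ k) ≡ + (suc k + top)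

Valid-[x]⇔ : ∀ {S top} x → top ∈ 0 ∷ S → Valid S top (x ∷ []) ⇔ (x ≡ + suc top)
Valid-[x]⇔ {S} {top} x top∈ =
  mk⇔ (λ (_ , _ , x≡) → x≡) λ { refl → admissible , (λ { Fin.zero Fin.zero () }) , refl }
  where
  admissible : ∀ i → AdmissibleEntry S (suc (toℕ i)) (lookup (+ suc top ∷ []) i)
  admissible Fin.zero = suc top , refl , from Admissible-1⇔ (top , top∈ , refl)

Valid-∷⇔ : ∀ {k S top x} {v : Vec ℤ (suc k)} →
  Valid S top (x ∷ v) ⇔ (∃[ h ] (x ≡ + suc h × h ∈ 0 ∷ S × Valid (nextGaps S h) (suc top) v))
Valid-∷⇔ {k} {S} {top} {x} {v} = mk⇔ to′ from′
  where
  to′ : Valid S top (x ∷ v) → ∃[ h ] (x ≡ + suc h × h ∈ 0 ∷ S × Valid (nextGaps S h) (suc top) v)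
  to′ (adm , sep , last) with adm Fin.zero
  ... | a , x≡ , adm₀ with to Admissible-1⇔ adm₀
  ...   | h , h∈ , refl =
    h , x≡ , h∈ , tail-admissible , proj₂ (Separated-∷⁻ sep) , trans last (cong +_ (sym (+-suc (suc k) top)))
    where
    tail-admissible : ∀ j → AdmissibleEntry (nextGaps S h) (suc (toℕ j)) (lookup v j)
    tail-admissible j = from (AdmissibleEntry-nextGaps S h)
      (adm (Fin.suc j) , subst (λ x → ClearOf x v) x≡ (proj₁ (Separated-∷⁻ sep)) j)

  from′ : ∃[ h ] (x ≡ + suc h × h ∈ 0 ∷ S × Valid (nextGaps S h) (suc top) v) → Valid S top (x ∷ v)
  from′ (h , refl , h∈ , adm , sep , last) =
    (λ { Fin.zero    → suc h , refl , from Admissible-1⇔ (h , h∈ , refl)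
       ; (Fin.suc j) → proj₁ (to (AdmissibleEntry-nextGaps S h) (adm j)) }) ,
    Separated-∷⁺ (λ j → proj₂ (to (AdmissibleEntry-nextGaps S h) (adm j))) sep ,
    trans last (cong +_ (+-suc (suc k) top))

withHeads : ∀ {m} → List ℕ → (ℕ → List (Vec ℤ m)) → List (Vec ℤ (suc m))
withHeads []      F = []
withHeads (h ∷ H) F = map (+ suc h ∷_) (F h) ++ withHeads H F

∈-withHeads⇔ : ∀ {m} H (F : ℕ → List (Vec ℤ m)) {x v} →
  (x ∷ v) ∈ withHeads H F ⇔ (∃[ h ] (x ≡ + suc h × h ∈ H × v ∈ F h))
∈-withHeads⇔ H F = mk⇔ (to′ H) (from′ H)
  where
  to′ : ∀ H {x v} → (x ∷ v) ∈ withHeads H F → ∃[ h ] (x ≡ + suc h × h ∈ H × v ∈ F h)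
  to′ (h ∷ H) x∷v∈ with ∈-++⁻ (map (+ suc h ∷_) (F h)) x∷v∈
  ... | inj₁ ∈map with ∈-map⁻ (+ suc h ∷_) ∈map
  ...   | w , w∈ , refl = h , refl , here refl , w∈
  to′ (h ∷ H) x∷v∈ | inj₂ ∈rest with to′ H ∈rest
  ...   | h′ , x≡ , h′∈ , v∈ = h′ , x≡ , there h′∈ , v∈

  from′ : ∀ H {x v} → ∃[ h ] (x ≡ + suc h × h ∈ H × v ∈ F h) → (x ∷ v) ∈ withHeads H F
  from′ (h ∷ H) (_ , refl , here refl , v∈) = ∈-++⁺ˡ (∈-map⁺ (+ suc h ∷_) v∈)
  from′ (h ∷ H) (_ , refl , there h∈ , v∈) =
    ∈-++⁺ʳ (map (+ suc h ∷_) (F h)) (from′ H (_ , refl , h∈ , v∈))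

length-withHeads : ∀ {m} H (F : ℕ → List (Vec ℤ m)) →
  length (withHeads H F) ≡ sum (map (length ∘ F) H)
length-withHeads []      F = refl
length-withHeads (h ∷ H) F = begin
  length (map (+ suc h ∷_) (F h) ++ withHeads H F)
    ≡⟨ length-++ (map (+ suc h ∷_) (F h)) ⟩
  length (map (+ suc h ∷_) (F h)) + length (withHeads H F)
    ≡⟨ cong₂ _+_ (length-map (+ suc h ∷_) (F h)) (length-withHeads H F) ⟩
  length (F h) + sum (map (length ∘ F) H)
    ∎
  where open ≡-Reasoning

withHeads-unique : ∀ {m} H (F : ℕ → List (Vec ℤ m)) →
  AllPairs _≢_ H → (∀ h → Unique (F h)) → Unique (withHeads H F)
withHeads-unique []      F _           _      = []
withHeads-unique (h ∷ H) F (h∉H ∷ H!) F-unique =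
  Unique.++⁺ (Unique.map⁺ ∷-injectiveʳ (F-unique h)) (withHeads-unique H F H! F-unique) disjoint
  where
  disjoint : ∀ {u} → ¬ (u ∈ map (+ suc h ∷_) (F h) × u ∈ withHeads H F)
  disjoint (u∈map , u∈rest) with ∈-map⁻ (+ suc h ∷_) u∈map
  ... | _ , _ , refl with to (∈-withHeads⇔ H F) u∈rest
  ...   | _ , refl , h∈H , _ = All.lookup h∉H h∈H refl

enumerate : (k : ℕ) → List ℕ → ℕ → List (Vec ℤ (suc k))
enumerate zero    S top = (+ suc top ∷ []) ∷ []
enumerate (suc k) S top = withHeads (0 ∷ S) λ h → enumerate k (nextGaps S h) (suc top)

TopGap : ℕ → List ℕ → Set
TopGap top S = top ∈ 0 ∷ S × All (_≤ top) (0 ∷ S)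

TopGap-nextGaps : ∀ {top S h} → TopGap top S → h ∈ 0 ∷ S → TopGap (suc top) (nextGaps S h)
TopGap-nextGaps {h = h} (top∈ , bounded) h∈ =
  there (∈-nextGaps⁺ top∈ (All.lookup bounded h∈)) ,
  z≤n ∷ All.map⁺ (All.map s≤s (All.filter⁺ (h ≤?_) bounded))

nextGaps-sorted : ∀ {S} h → AllPairs _<_ (0 ∷ S) → AllPairs _<_ (0 ∷ nextGaps S h)
nextGaps-sorted {S} h sorted =
  All.map⁺ (All.universal (λ _ → z<s) (filter (h ≤?_) (0 ∷ S))) ∷
  AllPairs.map⁺ (AllPairs.map s<s (AllPairs.filter⁺ (h ≤?_) sorted))

∈-enumerate⇔ : ∀ k {S top} → TopGap top S →
  (u : Vec ℤ (suc k)) → u ∈ enumerate k S top ⇔ Valid S top u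
∈-enumerate⇔ zero    {S} {top} topGap (x ∷ []) = mk⇔
  (λ { (here refl) → from (Valid-[x]⇔ x (proj₁ topGap)) refl })
  (λ valid → here (cong (_∷ []) (to (Valid-[x]⇔ x (proj₁ topGap)) valid)))
∈-enumerate⇔ (suc k) {S} {top} topGap (x ∷ v) = mk⇔
  (λ x∷v∈ → let (h , x≡ , h∈ , v∈) = to (∈-withHeads⇔ (0 ∷ S) F) x∷v∈ in
     from Valid-∷⇔ (h , x≡ , h∈ , to (tail h∈ v) v∈))
  (λ valid → let (h , x≡ , h∈ , v-valid) = to Valid-∷⇔ valid in
     from (∈-withHeads⇔ (0 ∷ S) F) (h , x≡ , h∈ , from (tail h∈ v) v-valid))
  where
  F : ℕ → List (Vec ℤ (suc k))
  F h = enumerate k (nextGaps S h) (suc top)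
  tail : ∀ {h} → h ∈ 0 ∷ S → ∀ v → v ∈ F h ⇔ Valid (nextGaps S h) (suc top) v
  tail h∈ = ∈-enumerate⇔ k (TopGap-nextGaps topGap h∈)

enumerate-unique : ∀ k {S} top → AllPairs _<_ (0 ∷ S) → Unique (enumerate k S top)
enumerate-unique zero    top _      = [] ∷ []
enumerate-unique (suc k) {S} top sorted =
  withHeads-unique (0 ∷ S) _ (AllPairs.map <⇒≢ sorted)
    λ h → enumerate-unique k (suc top) (nextGaps-sorted h sorted)

sum-map-length-filter : ∀ (f : ℕ → ℕ) T → AllPairs _<_ T →
  sum (map (λ t → f (length (filter (t ≤?_) T))) T) ≡ sum₁ (length T) f
sum-map-length-filter f []       []               = refl
sum-map-length-filter f (t ∷ T) (t<T ∷ T-sorted) = cong₂ _+_ first rest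
  where
  first : f (length (filter (t ≤?_) (t ∷ T))) ≡ f (suc (length T))
  first = cong (f ∘ length)
    (trans (filter-accept (t ≤?_) (≤-refl {t})) (cong (t ∷_) (filter-all (t ≤?_) (All.map <⇒≤ t<T))))
  rest : sum (map (λ t′ → f (length (filter (t′ ≤?_) (t ∷ T)))) T) ≡ sum₁ (length T) f
  rest = trans (cong sum (map-cong-local (All.map dropped t<T))) (sum-map-length-filter f T T-sorted)
    where
    dropped : ∀ {t′} → t < t′ → f (length (filter (t′ ≤?_) (t ∷ T))) ≡ f (length (filter (t′ ≤?_) T))
    dropped {t′} t<t′ = cong (f ∘ length) (filter-reject (t′ ≤?_) (<⇒≱ t<t′))

length-enumerate : ∀ k {S} top → AllPairs _<_ (0 ∷ S) →
  length (enumerate k S top) ≡ ballot k (length S)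
length-enumerate zero    top _ = refl
length-enumerate (suc k) {S} top sorted = begin
  length (withHeads (0 ∷ S) F)
    ≡⟨ length-withHeads (0 ∷ S) F ⟩
  sum (map (length ∘ F) (0 ∷ S))
    ≡⟨ cong sum (map-cong count (0 ∷ S)) ⟩
  sum (map (λ h → ballot k (length (filter (h ≤?_) (0 ∷ S)))) (0 ∷ S))
    ≡⟨ sum-map-length-filter (ballot k) (0 ∷ S) sorted ⟩
  ballot (suc k) (length S)
    ∎
  where
  open ≡-Reasoning
  F : ℕ → List (Vec ℤ (suc k))
  F h = enumerate k (nextGaps S h) (suc top)
  count : ∀ h → length (F h) ≡ ballot k (length (filter (h ≤?_) (0 ∷ S)))
  count h = trans (length-enumerate k (suc top) (nextGaps-sorted h sorted))
                  (cong (ballot k) (length-map suc (filter (h ≤?_) (0 ∷ S))))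

applyUpTo-sorted : ∀ s → AllPairs _<_ (0 ∷ applyUpTo suc s)
applyUpTo-sorted s = All.applyUpTo⁺₂ suc s (λ _ → z<s) ∷ AllPairs.applyUpTo⁺₁ suc s (λ i<j _ → s<s i<j)

applyUpTo-TopGap : ∀ s → TopGap s (applyUpTo suc s)
applyUpTo-TopGap s = top∈ s , z≤n ∷ All.applyUpTo⁺₁ suc s (λ i<s → i<s)
  where
  top∈ : ∀ s → s ∈ 0 ∷ applyUpTo suc s
  top∈ zero    = here refl
  top∈ (suc s) = there (∈-applyUpTo⁺ suc (n<1+n s))

Admissible-applyUpTo : ∀ {s p a} → 1 ≤ a → a ≤ p + s → Admissible (applyUpTo suc s) p a
Admissible-applyUpTo {s} {p} {a} 1≤a a≤p+s with a ≤? p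
... | yes a≤p = inj₁ (1≤a , a≤p)
... | no  a≰p with m≤n⇒∃[o]m+o≡n (≰⇒> a≰p)
...   | o , refl = inj₂ (suc o , ∈-applyUpTo⁺ suc o<s , sym (+-suc p o))
  where
  o<s : o < s
  o<s = +-cancelˡ-≤ p (suc o) s (subst (_≤ p + s) (sym (+-suc p o)) a≤p+s)

+1≤y⇒y≡+suc : ∀ {y} → + 1 ℤ.≤ y → ∃[ a ] (y ≡ + suc a)
+1≤y⇒y≡+suc {+ suc a} _             = a , refl
+1≤y⇒y≡+suc {+ zero}  (ℤ.+≤+ ())

InD⇒uᵢ≤i+s : ∀ {k s} {u : Vec ℤ (suc k)} → InD (suc k) s u →
  ∀ i {a} → lookup u i ≡ + suc a → suc a ≤ suc (toℕ i) + s
InD⇒uᵢ≤i+s {k} {s} {u} (_ , last , sep) i {a} uᵢ≡ with m≤n⇒m<n∨m≡n (toℕ≤pred[n] i)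
... | inj₂ i≡k =
  ≤-reflexive (trans (ℤ.+-injective (trans (sym uᵢ≡) (last i i≡k))) (cong (λ j → suc j + s) (sym i≡k)))
... | inj₁ i<k = +-cancelˡ-< d a (suc (toℕ i) + s) (subst (d + a <_) split (≰⇒> beyond))
  where
  d : ℕ
  d = k ∸ toℕ i
  split : suc k + s ≡ d + (suc (toℕ i) + s)
  split = begin
    suc k + s             ≡⟨ cong (λ k → suc k + s) (m∸n+n≡m (<⇒≤ i<k)) ⟨
    suc (d + toℕ i) + s   ≡⟨ cong (_+ s) (+-suc d (toℕ i)) ⟨
    d + suc (toℕ i) + s   ≡⟨ +-assoc d (suc (toℕ i)) s ⟩
    d + (suc (toℕ i) + s) ∎
    where open ≡-Reasoning
  clear : ¬ ((lookup u (fromℕ k) - + (toℕ (fromℕ k) ∸ toℕ i)) ∈[ + 1 , lookup u i - + 1 ]) →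
          ¬ ((+ (suc k + s) - + d) ∈[ + 1 , + a ])
  clear rewrite last (fromℕ k) (toℕ-fromℕ k) | toℕ-fromℕ k | uᵢ≡ = id
  beyond : ¬ (suc k + s ≤ d + a)
  beyond le = clear (sep i (fromℕ k) (subst (toℕ i <_) (sym (toℕ-fromℕ k)) i<k))
    (from (+b-+p∈[1,+t]⇔p<b≤p+t d (suc k + s) a) (s≤s (≤-trans (m∸n≤m k (toℕ i)) (m≤m+n k s)) , le))

InD⇔Valid : ∀ k s (u : Vec ℤ (suc k)) → InD (suc k) s u ⇔ Valid (applyUpTo suc s) s u
InD⇔Valid k s u = mk⇔
  (λ inD@(pos , last , sep) →
     (λ i → let (a , uᵢ≡) = +1≤y⇒y≡+suc (pos i) in
        suc a , uᵢ≡ , Admissible-applyUpTo (s≤s z≤n) (InD⇒uᵢ≤i+s {u = u} inD i uᵢ≡)) ,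
     sep , last (fromℕ k) (toℕ-fromℕ k))
  (λ (adm , sep , last) →
     (λ i → let (a , uᵢ≡ , A) = adm i in subst (+ 1 ℤ.≤_) (sym uᵢ≡) (ℤ.+≤+ (Admissible⇒1≤ A))) ,
     (λ i i≡k → subst (λ j → lookup u j ≡ + (suc k + s)) (toℕ-injective (trans (toℕ-fromℕ k) (sym i≡k)))
                      last) ,
     sep)

proposition4 : (n s : ℕ) → 1 ≤ n →
    Σ (List (Vec ℤ n)) (λ L →
      Unique L × ((u : Vec ℤ n) → (u ∈ L) ⇔ InD n s u) × (length L ≡ Cat (n ∸ 1) s))
proposition4 (suc k) s (s≤s z≤n) =
  enumerate k gaps s ,
  enumerate-unique k s (applyUpTo-sorted s) ,
  (λ u → ⇔.trans (∈-enumerate⇔ k (applyUpTo-TopGap s) u) (⇔.sym (InD⇔Valid k s u))) ,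
  (begin
    length (enumerate k gaps s) ≡⟨ length-enumerate k s (applyUpTo-sorted s) ⟩
    ballot k (length gaps)      ≡⟨ cong (ballot k) (length-applyUpTo suc s) ⟩
    ballot k s                  ≡⟨ Cat≡ballot k s ⟨
    Cat k s                     ∎)
  where
  open ≡-Reasoning
  gaps : List ℕ
  gaps = applyUpTo suc s
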